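{- Let $C$ be a global constraint over sequences of variables, and let $C_{app}$ be the tightest contractible approximation of $C$, i.e. the constraint whose language is $L_{C_{app}} = P(L_C)$. Suppose we have closed propagators for $C_{app}$ and for $C$ that each maintain domain consistency for the sequence $\vec{X}$. Then Bart\'{a}k's proposal (run the propagator for $C_{app}$, extended to accept additional variables appended to the right-hand end of $\vec{X}$, for as long as the constraint is open; once $\vec{X}$ is closed, replace it by the closed propagator for $C$) maintains open D-consistency for $C$.
   Context: A global constraint $C$ is a relation on a single sequence of variables $\vec{X}=[X_1,\ldots,X_n]$ (of any length $n$); its semantics is the formal language $L_C$, where a word $d_1\cdots d_n\in L_C$ iff $X_1=d_1,\ldots,X_n=d_n$ is a solution of $C([X_1,\ldots,X_n])$. For a language $L$, $P(L)=\{w \mid \exists u\; wu\in L\}$ is its prefix-closure. An open constraint is one to which variables may be added at the right-hand end of its sequence until it is declared closed; an occurrence of the constraint is its state at some point of execution. Each variable $X$ has a domain $D(X)$ of values. A closed constraint $C(X_1,\ldots,X_n)$ is domain consistent if for every $i$ and every $d\in D(X_i)$ there is a word $d_1\cdots d_n\in L_C$ with $d_i=d$ and $d_j\in D(X_j)$ for all $j$. An occurrence of $C(\vec{X})$ is open D-consistent if for every $X_i\in\vec{X}$ and every $d\in D(X_i)$ there is a word $d_1\cdots d_m\in L_C$ with $d_i=d$, $|\vec{X}|\le m$, and $d_j\in D(X_j)$ for $j=1,\ldots,|\vec{X}|$. -}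

module Defs where

open import Data.Nat using (ℕ; _≤_)
open import Data.Fin using (Fin; inject≤)
open import Data.Vec using (Vec; lookup; toList)
open import Data.List using (List; _++_)
open import Data.Product using (Σ; ∃; ∃-syntax; _×_)
open import Relation.Binary.PropositionalEquality using (_≡_)

-- A global constraint over values in A is given by its semantics:
-- a formal language L_C over the alphabet A (a predicate on words).
Language : Set → Set₁
Language A = List A → Set

P : {A : Set} → Language A → Language A
P L w = ∃[ u ] L (w ++ u)

-- Domains of a sequence of variables X₁ … Xₙ : D i d  means  d ∈ D(X_i).
Domains : Set → ℕ → Set₁
Domains A n = Fin n → A → Set

DomainConsistent : {A : Set} → Language A → (n : ℕ) → Domains A n → Set
DomainConsistent {A} L n D =
  (i : Fin n) (d : A) → D i d →
  Σ (Vec A n) λ w → L (toList w) × lookup w i ≡ d × ((j : Fin n) → D j (lookup w j))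

OpenDConsistent : {A : Set} → Language A → (n : ℕ) → Domains A n → Set
OpenDConsistent {A} L n D =
  (i : Fin n) (d : A) → D i d →
  Σ ℕ λ m → Σ (n ≤ m) λ n≤m → Σ (Vec A m) λ w →
    L (toList w) × lookup w (inject≤ i n≤m) ≡ d
      × ((j : Fin n) → D j (lookup w (inject≤ j n≤m)))

data Status : Set where
  open' closed : Status

-- Barták's proposal: while open, the propagator for C_app (language P(L_C))
-- runs on the current sequence; once closed, the propagator for C runs.
-- This gives the language whose domain consistency is maintained.
bartakLanguage : {A : Set} → Language A → Status → Language A
bartakLanguage L open'  = P L
bartakLanguage L closed = L

-- A support of the prefix-closed language extends to a word of L whose first
-- n letters are the support itself; this longer word is an open support.
-- The closed case reduces to this one because L ⊆ P L.

module Submission where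

open import Defs
open import Data.Nat using (ℕ; _≤_; _+_; s≤s⁻¹)
open import Data.Nat.Properties using (m≤m+n)
open import Data.Fin using (Fin; zero; suc; inject≤)
open import Data.Vec using (Vec; _∷_; lookup; toList; fromList; _++_)
open import Data.Vec.Properties using (toList-++; toList∘fromList)
open import Data.List as List using (List; []; length)
open import Data.List.Properties using (++-identityʳ)
open import Data.Product using (_,_)
open import Relation.Binary.PropositionalEquality using (_≡_; refl; sym; trans; subst; cong)

private
  variable
    A : Set

_⊆_ : Language A → Language A → Set
L ⊆ L′ = ∀ w → L w → L′ w

⊆-P : (L : Language A) → L ⊆ P L
⊆-P L w w∈L = [] , subst L (sym (++-identityʳ w)) w∈L

bartakLanguage⊆P : (L : Language A) (s : Status) → bartakLanguage L s ⊆ P L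
bartakLanguage⊆P L open'  w w∈PL = w∈PL
bartakLanguage⊆P L closed w w∈L  = ⊆-P L w w∈L

DomainConsistent-mono : {L L′ : Language A} → L ⊆ L′ →
  ∀ n (D : Domains A n) → DomainConsistent L n D → DomainConsistent L′ n D
DomainConsistent-mono L⊆L′ n D dc i d dᵢ with dc i d dᵢ
... | w , w∈L , wᵢ≡d , w∈D = w , L⊆L′ (toList w) w∈L , wᵢ≡d , w∈D

lookup-++-inject≤ : ∀ {n k} (w : Vec A n) (v : Vec A k) (i : Fin n) .(p : n ≤ n + k) →
  lookup (w ++ v) (inject≤ i p) ≡ lookup w i
lookup-++-inject≤ (x ∷ w) v zero    _ = refl
lookup-++-inject≤ (x ∷ w) v (suc i) p = lookup-++-inject≤ w v i (s≤s⁻¹ p)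

toList-++-fromList : ∀ {n} (w : Vec A n) (u : List A) →
  toList (w ++ fromList u) ≡ toList w List.++ u
toList-++-fromList w u = trans (toList-++ w (fromList u)) (cong (toList w List.++_) (toList∘fromList u))

DomainConsistent-P⇒OpenDConsistent : (L : Language A) (n : ℕ) (D : Domains A n) →
  DomainConsistent (P L) n D → OpenDConsistent L n D
DomainConsistent-P⇒OpenDConsistent L n D dc i d dᵢ with dc i d dᵢ
... | w , (u , wu∈L) , wᵢ≡d , w∈D =
  n + length u , n≤m , w ++ fromList u ,
  subst L (sym (toList-++-fromList w u)) wu∈L ,
  trans (lookup-++-inject≤ w (fromList u) i n≤m) wᵢ≡d ,
  λ j → subst (D j) (sym (lookup-++-inject≤ w (fromList u) j n≤m)) (w∈D j)
  where
  n≤m : n ≤ n + length u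
  n≤m = m≤m+n n (length u)

theorem1 : {A : Set} (L : Language A) (s : Status) (n : ℕ) (D : Domains A n) →
    DomainConsistent (bartakLanguage L s) n D → OpenDConsistent L n D
theorem1 L s n D dc =
  DomainConsistent-P⇒OpenDConsistent L n D
    (DomainConsistent-mono (bartakLanguage⊆P L s) n D dc)
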